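{- Let $G=(V,E)$ be a simple graph, let $k>2$ and $s$ be integers with $1\le s\le\frac{k}{2}$, and let $G^{k,s}$ be the generalized power hypergraph of $G$ with vertex set $V^{k,s}$ and signless Laplacian tensor $\mathscr{Q}^{k,s}$. Then the partition of $V^{k,s}$ into the sets $V_e$ ($e\in E$) and $V_v$ ($v\in V$) (omitting the empty sets $V_e$ when $s=\frac{k}{2}$) is an equitable partition of $V^{k,s}$ corresponding to the tensor $\mathscr{Q}^{k,s}$.
   Context: Generalized power hypergraph: for a simple graph $G=(V,E)$, an integer $k\ge2$ and $1\le s\le k/2$, $G^{k,s}$ is the $k$-uniform hypergraph obtained by taking, for each $v\in V$, a set $V_v$ of $s$ new vertices and, for each $e\in E$, a set $V_e$ of $k-2s$ new vertices (all these sets pairwise disjoint), with vertex set $V^{k,s}=\bigcup_{v}V_v\cup\bigcup_e V_e$ and edge set $\{V_u\cup V_v\cup V_e: e=uv\in E\}$. The adjacency tensor $\mathscr{A}^{k,s}$ of $G^{k,s}$ is the order $k$ tensor indexed by $V^{k,s}$ with entry $\frac{1}{(k-1)!}$ at $(i_1,\dots,i_k)$ if $\{i_1,\dots,i_k\}$ is an edge and $0$ otherwise; $\mathscr{Q}^{k,s}=\mathscr{D}^{k,s}+\mathscr{A}^{k,s}$, where $\mathscr{D}^{k,s}$ is the diagonal tensor of vertex degrees. For a tensor $\mathscr{T}=(t_{i_1\cdots i_k})$ indexed by a set $N$ and a partition $\{W_1,\dots,W_m\}$ of $N$ into nonempty sets, the quotient tensor $\mathscr{B}$ has entries $b_{ii_2\cdots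 i_k}=\frac{1}{|W_i|}\sum_{j\in W_i}\sum_{j_2\in W_{i_2},\dots,j_k\in W_{i_k}}t_{jj_2\cdots j_k}$, and the partition is equitable corresponding to $\mathscr{T}$ if $\sum_{j_2\in W_{i_2},\dots,j_k\in W_{i_k}}t_{jj_2\cdots j_k}=b_{ii_2\cdots i_k}$ for all $i,i_2,\dots,i_k$ and all $j\in W_i$. -}

module Defs where

open import Data.Bool using (Bool; true; false; _∧_; _∨_; not; if_then_else_)
open import Data.Nat using (ℕ; zero; suc; _+_; _*_; _∸_; _!)
open import Data.Nat.Properties using (_!≢0)
open import Data.Fin using (Fin; zero; suc; _≟_; splitAt; remQuot; _↑ˡ_; _↑ʳ_)
import Data.Fin as F
open import Data.Vec using (Vec; []; _∷_)
open import Data.Product using (_×_; _,_; proj₁; proj₂; ∃)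
open import Data.Sum using (_⊎_; inj₁; inj₂)
open import Data.Integer using (+_)
open import Data.Rational using (ℚ; 0ℚ; _/_) renaming (_+_ to _+ℚ_; _*_ to _*ℚ_)
open import Relation.Nullary using (does)
open import Relation.Binary.PropositionalEquality using (_≡_)
open import Function.Definitions using (Injective)

sumFin : ∀ N → (Fin N → ℚ) → ℚ
sumFin zero    f = 0ℚ
sumFin (suc N) f = f zero +ℚ sumFin N (λ i → f (suc i))

countFin : ∀ N → (Fin N → Bool) → ℕ
countFin zero    p = 0
countFin (suc N) p = (if p zero then 1 else 0) + countFin N (λ i → p (suc i))

anyFin : ∀ N → (Fin N → Bool) → Bool
anyFin zero    p = false
anyFin (suc N) p = p zero ∨ anyFin N (λ i → p (suc i))

allFin : ∀ N → (Fin N → Bool) → Bool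
allFin zero    p = true
allFin (suc N) p = p zero ∧ allFin N (λ i → p (suc i))

sumTup : ∀ N r → (Vec (Fin N) r → ℚ) → ℚ
sumTup N zero    f = f []
sumTup N (suc r) f = sumFin N (λ j → sumTup N r (λ js → f (j ∷ js)))

allV : ∀ {A : Set} {r} → (A → Bool) → Vec A r → Bool
allV p []       = true
allV p (x ∷ xs) = p x ∧ allV p xs

memV : ∀ {N r} → Fin N → Vec (Fin N) r → Bool
memV y []       = false
memV y (x ∷ xs) = does (y ≟ x) ∨ memV y xs

Tensor : ℕ → ℕ → Set
Tensor N k = Vec (Fin N) k → ℚ

-- A partition {W₁,…,W_M} of Fin N is given by its block map π : Fin N → Fin M
-- (W_i = π⁻¹(i)); all blocks are required to be nonempty.
AllBlocksNonempty : ∀ {N M} → (Fin N → Fin M) → Set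
AllBlocksNonempty {N} {M} π = (i : Fin M) → ∃ λ (j : Fin N) → π j ≡ i

inBlocks : ∀ {N M r} → (Fin N → Fin M) → Vec (Fin N) r → Vec (Fin M) r → Bool
inBlocks π []       []       = true
inBlocks π (j ∷ js) (i ∷ is) = does (π j ≟ i) ∧ inBlocks π js is

blockSum : ∀ {N M} k → Tensor N k → (Fin N → Fin M) → Fin N → Vec (Fin M) (k ∸ 1) → ℚ
blockSum zero    T π j is = 0ℚ
blockSum {N} (suc r) T π j is =
  sumTup N r (λ js → if inBlocks π js is then T (j ∷ js) else 0ℚ)

blockSize : ∀ {N M} → (Fin N → Fin M) → Fin M → ℕ
blockSize {N} π i = countFin N (λ j → does (π j ≟ i))

-- quotient tensor entry b_{i i₂ ⋯ iₖ} = (1/|W_i|) Σ_{j∈W_i} Σ_{j₂∈W_{i₂},…} t_{j j₂ ⋯ jₖ}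
-- (blocks are nonempty in any partition; the value for an empty block is irrelevant)
quotientEntry : ∀ {N M} k → Tensor N k → (Fin N → Fin M) → Fin M → Vec (Fin M) (k ∸ 1) → ℚ
quotientEntry {N} k T π i is with blockSize π i
... | zero  = 0ℚ
... | suc c = (+ 1 / suc c) *ℚ
              sumFin N (λ j → if does (π j ≟ i) then blockSum k T π j is else 0ℚ)

IsEquitable : ∀ {N M} k → Tensor N k → (Fin N → Fin M) → Set
IsEquitable {N} {M} k T π =
  AllBlocksNonempty π ×
  ((i : Fin M) (is : Vec (Fin M) (k ∸ 1)) (j : Fin N) → π j ≡ i →
     blockSum k T π j is ≡ quotientEntry k T π i is)

-- Simple graphs on vertex set Fin n, with m edges labelled by Fin m.
-- Edge e joins endpoints (u , w) with u < w (no loops); distinct labels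
-- give distinct edges (no multiple edges).

record Graph (n : ℕ) : Set where
  field
    m       : ℕ
    ends    : Fin m → Fin n × Fin n
    ordered : ∀ e → proj₁ (ends e) F.< proj₂ (ends e)
    simple  : Injective _≡_ _≡_ ends

module Power {n : ℕ} (G : Graph n) (k s : ℕ) where
  open Graph G

  -- |V_e| = k - 2s
  d : ℕ
  d = k ∸ 2 * s

  -- vertex set V^{k,s} : first the n·s vertices ⋃_v V_v, then the m·d vertices ⋃_e V_e
  N : ℕ
  N = n * s + m * d

  -- decoding: inj₁ (v , t) is the t-th vertex of V_v, inj₂ (e , t) the t-th vertex of V_e
  decode : Fin N → (Fin n × Fin s) ⊎ (Fin m × Fin d)
  decode x with splitAt (n * s) x
  ... | inj₁ y = inj₁ (remQuot s y)
  ... | inj₂ y = inj₂ (remQuot d y)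

  -- x ∈ V_u ∪ V_w ∪ V_e, the hyperedge of e = uw
  inEdge : Fin m → Fin N → Bool
  inEdge e x with decode x
  ... | inj₁ (v , _)  = does (v ≟ proj₁ (ends e)) ∨ does (v ≟ proj₂ (ends e))
  ... | inj₂ (e′ , _) = does (e′ ≟ e)

  isEdge : Vec (Fin N) k → Bool
  isEdge is = anyFin m (λ e →
    allV (inEdge e) is ∧ allFin N (λ y → not (inEdge e y) ∨ memV y is))

  degree : Fin N → ℕ
  degree x = countFin m (λ e → inEdge e x)

  adjacency : Tensor N k
  adjacency is = if isEdge is then (+ 1 / ((k ∸ 1) !)) {{(k ∸ 1) !≢0}} else 0ℚ

  allEqual : ∀ {r} → Fin N → Vec (Fin N) r → Bool
  allEqual i []       = true
  allEqual i (j ∷ js) = does (i ≟ j) ∧ allEqual i js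

  degreeTensor : Tensor N k
  degreeTensor []       = 0ℚ
  degreeTensor (i ∷ is) = if allEqual i is then + degree i / 1 else 0ℚ

  signlessLaplacian : Tensor N k
  signlessLaplacian is = degreeTensor is +ℚ adjacency is

  -- number of edge-blocks V_e : m if k - 2s > 0, none if k = 2s (empty V_e omitted)
  edgeBlocks : ℕ → ℕ
  edgeBlocks zero    = 0
  edgeBlocks (suc _) = m

  -- blocks: V_v (v ∈ Fin n) come first, then V_e (e ∈ Fin m) when d > 0
  M : ℕ
  M = n + edgeBlocks d

  edgeBlock : ∀ d′ → Fin m → Fin d′ → Fin (n + edgeBlocks d′)
  edgeBlock (suc _) e _ = n ↑ʳ e

  partition : Fin N → Fin M
  partition x with decode x
  ... | inj₁ (v , _) = v ↑ˡ edgeBlocks d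
  ... | inj₂ (e , t) = edgeBlock d e t

module Submission where

-- The partition of V^{k,s} into the blocks V_v and V_e is equitable for the
-- signless Laplacian tensor Q^{k,s} because every block is an orbit of
-- symmetries of Q^{k,s}: any two vertices of the same block can be swapped
-- without changing which hyperedges each vertex lies in.

open import Defs
open import Algebra.Bundles using (Ring)
import Algebra.Properties.CommutativeMonoid.Sum as CommutativeMonoidSum
open import Data.Bool using (Bool; true; false; _∧_; _∨_; not; if_then_else_)
import Data.Bool.Properties as BoolP
open import Data.Empty using (⊥; ⊥-elim)
open import Data.Fin using (Fin; zero; suc; _≟_; _↑ˡ_; _↑ʳ_; splitAt; remQuot; combine; join; toℕ)
import Data.Fin.Properties as FinP
open import Data.Fin.Permutation using (Permutation′; _⟨$⟩ʳ_; _⟨$⟩ˡ_; inverseˡ; inverseʳ; flip; transpose)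
import Data.Fin.Permutation.Components as Transposition
import Data.Integer as ℤ
open import Data.Integer using (+_)
import Data.Integer.Properties as ℤP
open import Data.Nat using (ℕ; zero; suc; _+_; _*_; _<_; _≤_; z≤n; s≤s)
import Data.Nat.Properties as ℕP
open import Data.Product using (_×_; _,_; proj₁; proj₂; ∃-syntax)
open import Data.Rational using (ℚ; 0ℚ; 1ℚ; _/_; toℚᵘ) renaming (_+_ to _+ℚ_; _*_ to _*ℚ_)
import Data.Rational.Properties as ℚP
import Data.Rational.Unnormalised as ℚᵘ
import Data.Rational.Unnormalised.Properties as ℚᵘP
open import Data.Sum using (_⊎_; inj₁; inj₂)
open import Data.Vec using (Vec; []; _∷_; map)
open import Function.Bundles using (mk⇔)
open import Relation.Binary.PropositionalEquality
open import Relation.Nullary using (does; yes; no)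
open import Relation.Nullary.Decidable using (dec-true; does-⇔)

open import Algebra.Properties.Semiring.Mult (Ring.semiring ℚP.+-*-ring) using (×-assoc-*) renaming (_×_ to _·_)

module ℚSum = CommutativeMonoidSum ℚP.+-0-commutativeMonoid
module ∧Fold = CommutativeMonoidSum BoolP.∧-commutativeMonoid

sumFin-cong : ∀ N {f g : Fin N → ℚ} → (∀ i → f i ≡ g i) → sumFin N f ≡ sumFin N g
sumFin-cong zero    f≗g = refl
sumFin-cong (suc N) f≗g = cong₂ _+ℚ_ (f≗g zero) (sumFin-cong N (λ i → f≗g (suc i)))

countFin-cong : ∀ N {p q : Fin N → Bool} → (∀ i → p i ≡ q i) → countFin N p ≡ countFin N q
countFin-cong zero    p≗q = refl
countFin-cong (suc N) p≗q =
  cong₂ (λ b c → (if b then 1 else 0) + c) (p≗q zero) (countFin-cong N (λ i → p≗q (suc i)))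

anyFin-cong : ∀ N {p q : Fin N → Bool} → (∀ i → p i ≡ q i) → anyFin N p ≡ anyFin N q
anyFin-cong zero    p≗q = refl
anyFin-cong (suc N) p≗q = cong₂ _∨_ (p≗q zero) (anyFin-cong N (λ i → p≗q (suc i)))

allFin-cong : ∀ N {p q : Fin N → Bool} → (∀ i → p i ≡ q i) → allFin N p ≡ allFin N q
allFin-cong zero    p≗q = refl
allFin-cong (suc N) p≗q = cong₂ _∧_ (p≗q zero) (allFin-cong N (λ i → p≗q (suc i)))

sumTup-cong : ∀ N r {f g : Vec (Fin N) r → ℚ} → (∀ v → f v ≡ g v) → sumTup N r f ≡ sumTup N r g
sumTup-cong N zero    f≗g = f≗g []
sumTup-cong N (suc r) f≗g = sumFin-cong N (λ j → sumTup-cong N r (λ js → f≗g (j ∷ js)))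

-- Reindexing by a permutation does not change a sum or a conjunction; this is
-- the library's commutative-monoid fold, to which sumFin and allFin agree.

sumFin-as-fold : ∀ N (f : Fin N → ℚ) → sumFin N f ≡ ℚSum.sum f
sumFin-as-fold zero    f = refl
sumFin-as-fold (suc N) f = cong (f zero +ℚ_) (sumFin-as-fold N (λ i → f (suc i)))

allFin-as-fold : ∀ N (p : Fin N → Bool) → allFin N p ≡ ∧Fold.sum p
allFin-as-fold zero    p = refl
allFin-as-fold (suc N) p = cong (p zero ∧_) (allFin-as-fold N (λ i → p (suc i)))

sumFin-permute : ∀ N (f : Fin N → ℚ) (P : Permutation′ N) →
  sumFin N f ≡ sumFin N (λ i → f (P ⟨$⟩ʳ i))
sumFin-permute N f P =
  trans (sumFin-as-fold N f) (trans (ℚSum.sum-permute f P) (sym (sumFin-as-fold N _)))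

allFin-permute : ∀ N (p : Fin N → Bool) (P : Permutation′ N) →
  allFin N p ≡ allFin N (λ i → p (P ⟨$⟩ʳ i))
allFin-permute N p P =
  trans (allFin-as-fold N p) (trans (∧Fold.sum-permute p P) (sym (allFin-as-fold N _)))

sumTup-permute : ∀ N r (f : Vec (Fin N) r → ℚ) (P : Permutation′ N) →
  sumTup N r f ≡ sumTup N r (λ v → f (map (P ⟨$⟩ʳ_) v))
sumTup-permute N zero    f P = refl
sumTup-permute N (suc r) f P =
  trans (sumFin-cong N (λ j → sumTup-permute N r (λ js → f (j ∷ js)) P))
        (sumFin-permute N _ P)

sumFin-indicator : ∀ N (p : Fin N → Bool) (B : ℚ) →
  sumFin N (λ x → if p x then B else 0ℚ) ≡ countFin N p · B
sumFin-indicator zero    p B = refl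
sumFin-indicator (suc N) p B with p zero
... | true  = cong (B +ℚ_) (sumFin-indicator N (λ i → p (suc i)) B)
... | false = trans (ℚP.+-identityˡ _) (sumFin-indicator N (λ i → p (suc i)) B)

countFin-nonzero : ∀ N (p : Fin N → Bool) j → p j ≡ true → countFin N p ≡ 0 → ⊥
countFin-nonzero (suc N) p zero    pj≡true count≡0 rewrite pj≡true = ℕP.1+n≢0 count≡0
countFin-nonzero (suc N) p (suc j) pj≡true count≡0 with p zero
... | true  = ℕP.1+n≢0 count≡0
... | false = countFin-nonzero N (λ i → p (suc i)) j pj≡true count≡0

multiple-of-one : ∀ n → toℚᵘ (n · 1ℚ) ℚᵘ.≃ ℚᵘ.mkℚᵘ (+ n) 0
multiple-of-one zero    = ℚᵘ.*≡* refl
multiple-of-one (suc n) =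
  ℚᵘP.≃-trans (ℚP.toℚᵘ-homo-+ 1ℚ (n · 1ℚ))
    (ℚᵘP.≃-trans (ℚᵘP.+-congʳ ℚᵘ.1ℚᵘ (multiple-of-one n))
      (ℚᵘ.*≡* (trans (ℤP.*-identityʳ _)
        (trans (cong (ℤ._+_ (+ 1)) (ℤP.*-identityʳ (+ n))) (sym (ℤP.*-identityʳ _))))))

reciprocal-cancels : ∀ c → (+ 1 / suc c) *ℚ (suc c · 1ℚ) ≡ 1ℚ
reciprocal-cancels c = ℚP.toℚᵘ-injective
  (ℚᵘP.≃-trans (ℚP.toℚᵘ-homo-* (+ 1 / suc c) (suc c · 1ℚ))
    (ℚᵘP.≃-trans (ℚᵘP.*-cong (ℚP.toℚᵘ-fromℚᵘ (ℚᵘ.mkℚᵘ (+ 1) c)) (multiple-of-one (suc c)))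
      (ℚᵘ.*≡* (ℤP.*-assoc (+ 1) (+ suc c) (+ 1)))))

average-of-copies : ∀ c B → (+ 1 / suc c) *ℚ (suc c · B) ≡ B
average-of-copies c B = begin
  (+ 1 / suc c) *ℚ (suc c · B)            ≡⟨ cong (λ x → (+ 1 / suc c) *ℚ (suc c · x)) (ℚP.*-identityˡ B) ⟨
  (+ 1 / suc c) *ℚ (suc c · (1ℚ *ℚ B))    ≡⟨ cong ((+ 1 / suc c) *ℚ_) (×-assoc-* (suc c) 1ℚ B) ⟨
  (+ 1 / suc c) *ℚ ((suc c · 1ℚ) *ℚ B)    ≡⟨ ℚP.*-assoc (+ 1 / suc c) (suc c · 1ℚ) B ⟨
  ((+ 1 / suc c) *ℚ (suc c · 1ℚ)) *ℚ B    ≡⟨ cong (_*ℚ B) (reciprocal-cancels c) ⟩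
  1ℚ *ℚ B                                 ≡⟨ ℚP.*-identityˡ B ⟩
  B                                       ∎
  where open ≡-Reasoning

module _ {N M : ℕ} (π : Fin N → Fin M) where

  inBlock : Fin M → Fin N → Bool
  inBlock i x = does (π x ≟ i)

  quotientEntry-of-constant : ∀ k (T : Tensor N k) i is j → π j ≡ i →
    (∀ x → π x ≡ i → blockSum k T π x is ≡ blockSum k T π j is) →
    blockSum k T π j is ≡ quotientEntry k T π i is
  quotientEntry-of-constant k T i is j πj≡i constant with blockSize π i in size≡
  ... | zero  = ⊥-elim (countFin-nonzero N (inBlock i) j (dec-true (π j ≟ i) πj≡i) size≡)
  ... | suc c = sym (begin
    (+ 1 / suc c) *ℚ sumFin N (λ x → if inBlock i x then blockSum k T π x is else 0ℚ)
      ≡⟨ cong ((+ 1 / suc c) *ℚ_) (sumFin-cong N constant-on-block) ⟩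
    (+ 1 / suc c) *ℚ sumFin N (λ x → if inBlock i x then B else 0ℚ)
      ≡⟨ cong ((+ 1 / suc c) *ℚ_) (sumFin-indicator N (inBlock i) B) ⟩
    (+ 1 / suc c) *ℚ (blockSize π i · B)
      ≡⟨ cong (λ n → (+ 1 / suc c) *ℚ (n · B)) size≡ ⟩
    (+ 1 / suc c) *ℚ (suc c · B)
      ≡⟨ average-of-copies c B ⟩
    B ∎)
    where
    open ≡-Reasoning
    B : ℚ
    B = blockSum k T π j is
    constant-on-block : ∀ x →
      (if inBlock i x then blockSum k T π x is else 0ℚ) ≡ (if inBlock i x then B else 0ℚ)
    constant-on-block x with π x ≟ i
    ... | yes πx≡i = constant x πx≡i
    ... | no  _    = refl

  IsSymmetry : ∀ {k} → Tensor N k → Permutation′ N → Set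
  IsSymmetry T P = (∀ x → π (P ⟨$⟩ʳ x) ≡ π x) × (∀ v → T (map (P ⟨$⟩ʳ_) v) ≡ T v)

  inBlocks-preserved : (ρ : Fin N → Fin N) → (∀ x → π (ρ x) ≡ π x) →
    ∀ {r} (js : Vec (Fin N) r) is → inBlocks π (map ρ js) is ≡ inBlocks π js is
  inBlocks-preserved ρ preserves []       []       = refl
  inBlocks-preserved ρ preserves (j ∷ js) (i ∷ is) =
    cong₂ (λ a b → does (a ≟ i) ∧ b) (preserves j) (inBlocks-preserved ρ preserves js is)

  -- Block sums are constant along a symmetry: reindex the sum by it.
  blockSum-symmetric : ∀ k (T : Tensor N k) (P : Permutation′ N) → IsSymmetry T P →
    ∀ j is → blockSum k T π (P ⟨$⟩ʳ j) is ≡ blockSum k T π j is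
  blockSum-symmetric zero    T P symmetry j is = refl
  blockSum-symmetric (suc r) T P (preserves-π , preserves-T) j is =
    trans (sumTup-permute N r _ P) (sumTup-cong N r reindexed)
    where
    reindexed : ∀ js →
      (if inBlocks π (map (P ⟨$⟩ʳ_) js) is then T ((P ⟨$⟩ʳ j) ∷ map (P ⟨$⟩ʳ_) js) else 0ℚ)
        ≡ (if inBlocks π js is then T (j ∷ js) else 0ℚ)
    reindexed js = cong₂ (if_then_else 0ℚ)
      (inBlocks-preserved (P ⟨$⟩ʳ_) preserves-π js is) (preserves-T (j ∷ js))

  equitable-if-blocks-are-orbits : ∀ k (T : Tensor N k) → AllBlocksNonempty π →
    (∀ j x → π j ≡ π x → ∃[ P ] IsSymmetry T P × P ⟨$⟩ʳ j ≡ x) →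
    IsEquitable k T π
  equitable-if-blocks-are-orbits k T nonempty transitive = nonempty , equitable
    where
    constant : ∀ j x is → π j ≡ π x → blockSum k T π x is ≡ blockSum k T π j is
    constant j x is πj≡πx with transitive j x πj≡πx
    ... | P , symmetry , Pj≡x = subst (λ y → blockSum k T π y is ≡ blockSum k T π j is)
                                      Pj≡x (blockSum-symmetric k T P symmetry j is)
    equitable : ∀ i is j → π j ≡ i → blockSum k T π j is ≡ quotientEntry k T π i is
    equitable i is j πj≡i = quotientEntry-of-constant k T i is j πj≡i
      (λ x πx≡i → constant j x is (trans πj≡i (sym πx≡i)))

does-≟-injective : ∀ {N} (ρ : Fin N → Fin N) → (∀ {x y} → ρ x ≡ ρ y → x ≡ y) →
  ∀ x y → does (ρ x ≟ ρ y) ≡ does (x ≟ y)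
does-≟-injective ρ injective x y = does-⇔ (mk⇔ injective (cong ρ)) (ρ x ≟ ρ y) (x ≟ y)

transposition-sends : ∀ {N} (i j : Fin N) → Transposition.transpose i j i ≡ j
transposition-sends i j rewrite dec-true (i ≟ i) refl = refl

transposition-preserves : ∀ {N} {A : Set} (f : Fin N → A) {i j} → f i ≡ f j →
  ∀ y → f (Transposition.transpose i j y) ≡ f y
transposition-preserves f {i} {j} fi≡fj y with y ≟ i
... | yes y≡i = trans (sym fi≡fj) (cong f (sym y≡i))
... | no  _   with y ≟ j
...   | yes y≡j = trans fi≡fj (cong f (sym y≡j))
...   | no  _   = refl

module PowerHypergraph {n : ℕ} (G : Graph n) (k s : ℕ) where
  open Graph G
  open Power G k s

  -- Q^{k,s} is invariant under every permutation of V^{k,s} that fixes each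
  -- hyperedge setwise: degrees, the diagonal pattern and the edge set are
  -- all defined through hyperedge membership.
  module EdgePreserving (P : Permutation′ N)
                        (preserves : ∀ e x → inEdge e (P ⟨$⟩ʳ x) ≡ inEdge e x) where

    ρ ρ⁻¹ : Fin N → Fin N
    ρ x   = P ⟨$⟩ʳ x
    ρ⁻¹ y = P ⟨$⟩ˡ y

    ρ-injective : ∀ {x y} → ρ x ≡ ρ y → x ≡ y
    ρ-injective ρx≡ρy = trans (sym (inverseˡ P)) (trans (cong ρ⁻¹ ρx≡ρy) (inverseˡ P))

    degree-preserved : ∀ x → degree (ρ x) ≡ degree x
    degree-preserved x = countFin-cong m (λ e → preserves e x)

    allEqual-preserved : ∀ {r} i (is : Vec (Fin N) r) → allEqual (ρ i) (map ρ is) ≡ allEqual i is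
    allEqual-preserved i []       = refl
    allEqual-preserved i (j ∷ js) =
      cong₂ _∧_ (does-≟-injective ρ ρ-injective i j) (allEqual-preserved i js)

    degreeTensor-preserved : ∀ v → degreeTensor (map ρ v) ≡ degreeTensor v
    degreeTensor-preserved []       = refl
    degreeTensor-preserved (i ∷ is) =
      cong₂ (λ b δ → if b then + δ / 1 else 0ℚ) (allEqual-preserved i is) (degree-preserved i)

    memV-moved : ∀ {r} y (v : Vec (Fin N) r) → memV y (map ρ v) ≡ memV (ρ⁻¹ y) v
    memV-moved y []       = refl
    memV-moved y (x ∷ xs) = cong₂ _∨_ (does-⇔ y≡ρx⇔ρ⁻¹y≡x (y ≟ ρ x) (ρ⁻¹ y ≟ x)) (memV-moved y xs)
      where
      y≡ρx⇔ρ⁻¹y≡x = mk⇔ (λ y≡ρx → trans (cong ρ⁻¹ y≡ρx) (inverseˡ P))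
                        (λ ρ⁻¹y≡x → trans (sym (inverseʳ P)) (cong ρ ρ⁻¹y≡x))

    allV-preserved : ∀ {r} e (v : Vec (Fin N) r) → allV (inEdge e) (map ρ v) ≡ allV (inEdge e) v
    allV-preserved e []       = refl
    allV-preserved e (x ∷ xs) = cong₂ _∧_ (preserves e x) (allV-preserved e xs)

    covers : Fin m → ∀ {r} → Vec (Fin N) r → Fin N → Bool
    covers e v y = not (inEdge e y) ∨ memV y v

    covers-moved : ∀ e {r} (v : Vec (Fin N) r) y → covers e (map ρ v) y ≡ covers e v (ρ⁻¹ y)
    covers-moved e v y = cong₂ (λ b c → not b ∨ c)
      (trans (cong (inEdge e) (sym (inverseʳ P))) (preserves e (ρ⁻¹ y)))
      (memV-moved y v)

    isEdge-preserved : ∀ v → isEdge (map ρ v) ≡ isEdge v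
    isEdge-preserved v = anyFin-cong m (λ e → cong₂ _∧_ (allV-preserved e v)
      (trans (allFin-cong N (covers-moved e v)) (sym (allFin-permute N (covers e v) (flip P)))))

    signlessLaplacian-preserved : ∀ v → signlessLaplacian (map ρ v) ≡ signlessLaplacian v
    signlessLaplacian-preserved v = cong₂ _+ℚ_ (degreeTensor-preserved v)
      (cong (λ b → if b then _ else 0ℚ) (isEdge-preserved v))

  Decoded : Set
  Decoded = (Fin n × Fin s) ⊎ (Fin m × Fin d)

  origin : Decoded → Fin n ⊎ Fin m
  origin (inj₁ (v , _)) = inj₁ v
  origin (inj₂ (e , _)) = inj₂ e

  originInEdge : Fin m → Fin n ⊎ Fin m → Bool
  originInEdge e (inj₁ v)  = does (v ≟ proj₁ (ends e)) ∨ does (v ≟ proj₂ (ends e))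
  originInEdge e (inj₂ e′) = does (e′ ≟ e)

  inEdge-via-origin : ∀ e x → inEdge e x ≡ originInEdge e (origin (decode x))
  inEdge-via-origin e x with decode x
  ... | inj₁ _ = refl
  ... | inj₂ _ = refl

  block : Decoded → Fin M
  block (inj₁ (v , _)) = v ↑ˡ edgeBlocks d
  block (inj₂ (e , t)) = edgeBlock d e t

  partition-via-decode : ∀ x → partition x ≡ block (decode x)
  partition-via-decode x with decode x
  ... | inj₁ _ = refl
  ... | inj₂ _ = refl

  vertexBlock≢edgeBlock : ∀ {d′} (v : Fin n) e (t : Fin d′) →
    v ↑ˡ edgeBlocks d′ ≡ edgeBlock d′ e t → ⊥
  vertexBlock≢edgeBlock {suc _} v e t v≡e = ℕP.<-irrefl refl (ℕP.<-≤-trans below above)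
    where
    below : toℕ (v ↑ˡ m) < n
    below = subst (_< n) (sym (FinP.toℕ-↑ˡ v m)) (FinP.toℕ<n v)
    above : n ≤ toℕ (v ↑ˡ m)
    above = subst (n ≤_) (trans (sym (FinP.toℕ-↑ʳ n e)) (cong toℕ (sym v≡e))) (ℕP.m≤m+n n (toℕ e))

  edgeBlock-injective : ∀ {d′} e e′ (t t′ : Fin d′) → edgeBlock d′ e t ≡ edgeBlock d′ e′ t′ → e ≡ e′
  edgeBlock-injective {suc _} e e′ t t′ = FinP.↑ʳ-injective n e e′

  block-determines-origin : ∀ a b → block a ≡ block b → origin a ≡ origin b
  block-determines-origin (inj₁ (v , _)) (inj₁ (v′ , _)) eq = cong inj₁ (FinP.↑ˡ-injective (edgeBlocks d) v v′ eq)
  block-determines-origin (inj₁ (v , _)) (inj₂ (e , t))  eq = ⊥-elim (vertexBlock≢edgeBlock v e t eq)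
  block-determines-origin (inj₂ (e , t)) (inj₁ (v , _))  eq = ⊥-elim (vertexBlock≢edgeBlock v e t (sym eq))
  block-determines-origin (inj₂ (e , t)) (inj₂ (e′ , t′)) eq = cong inj₂ (edgeBlock-injective e e′ t t′ eq)

  sameBlock⇒sameEdges : ∀ {x y} → partition x ≡ partition y → ∀ e → inEdge e x ≡ inEdge e y
  sameBlock⇒sameEdges {x} {y} πx≡πy e = begin
    inEdge e x                               ≡⟨ inEdge-via-origin e x ⟩
    originInEdge e (origin (decode x))       ≡⟨ cong (originInEdge e) (block-determines-origin (decode x) (decode y) blocks≡) ⟩
    originInEdge e (origin (decode y))       ≡⟨ inEdge-via-origin e y ⟨
    inEdge e y                               ∎
    where
    open ≡-Reasoning
    blocks≡ : block (decode x) ≡ block (decode y)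
    blocks≡ = trans (sym (partition-via-decode x)) (trans πx≡πy (partition-via-decode y))

  blocks-are-orbits : ∀ j x → partition j ≡ partition x →
    ∃[ P ] IsSymmetry partition signlessLaplacian P × P ⟨$⟩ʳ j ≡ x
  blocks-are-orbits j x πj≡πx =
    transpose j x ,
    (transposition-preserves partition πj≡πx ,
     EdgePreserving.signlessLaplacian-preserved (transpose j x)
       (λ e → transposition-preserves (inEdge e) (sameBlock⇒sameEdges πj≡πx e))) ,
    transposition-sends j x

  encode : Decoded → Fin N
  encode (inj₁ (v , t)) = combine v t ↑ˡ (m * d)
  encode (inj₂ (e , t)) = (n * s) ↑ʳ combine e t

  decodeSplit : Fin (n * s) ⊎ Fin (m * d) → Decoded
  decodeSplit (inj₁ y) = inj₁ (remQuot s y)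
  decodeSplit (inj₂ y) = inj₂ (remQuot d y)

  decode-via-split : ∀ x → decode x ≡ decodeSplit (splitAt (n * s) x)
  decode-via-split x with splitAt (n * s) x
  ... | inj₁ _ = refl
  ... | inj₂ _ = refl

  decode-encode : ∀ a → decode (encode a) ≡ a
  decode-encode (inj₁ (v , t)) = begin
    decode (combine v t ↑ˡ (m * d))                         ≡⟨ decode-via-split _ ⟩
    decodeSplit (splitAt (n * s) (combine v t ↑ˡ (m * d)))  ≡⟨ cong decodeSplit (FinP.splitAt-↑ˡ (n * s) (combine v t) (m * d)) ⟩
    inj₁ (remQuot s (combine v t))                          ≡⟨ cong inj₁ (FinP.remQuot-combine v t) ⟩
    inj₁ (v , t)                                            ∎
    where open ≡-Reasoning
  decode-encode (inj₂ (e , t)) = begin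
    decode ((n * s) ↑ʳ combine e t)                         ≡⟨ decode-via-split _ ⟩
    decodeSplit (splitAt (n * s) ((n * s) ↑ʳ combine e t))  ≡⟨ cong decodeSplit (FinP.splitAt-↑ʳ (n * s) (m * d) (combine e t)) ⟩
    inj₂ (remQuot d (combine e t))                          ≡⟨ cong inj₂ (FinP.remQuot-combine e t) ⟩
    inj₂ (e , t)                                            ∎
    where open ≡-Reasoning

  -- Every block is the block of some decoded vertex (given s ≥ 1, so that
  -- the sets V_v are nonempty; the sets V_e are only listed when nonempty).
  block-surjective : Fin s → ∀ i → ∃[ a ] block a ≡ i
  block-surjective t₀ i = covering (splitAt n i) (FinP.join-splitAt n (edgeBlocks d) i)
    where
    edgeWitness : ∀ d′ (e : Fin (edgeBlocks d′)) → ∃[ e′ ] ∃[ t ] edgeBlock d′ e′ t ≡ n ↑ʳ e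
    edgeWitness (suc _) e = e , zero , refl
    covering : ∀ w → join n (edgeBlocks d) w ≡ i → ∃[ a ] block a ≡ i
    covering (inj₁ v) v≡i = inj₁ (v , t₀) , v≡i
    covering (inj₂ e) e≡i with edgeWitness d e
    ... | e′ , t , edge≡ = inj₂ (e′ , t) , trans edge≡ e≡i

  blocks-nonempty : Fin s → AllBlocksNonempty partition
  blocks-nonempty t₀ i with block-surjective t₀ i
  ... | a , block≡i = encode a , (begin
    partition (encode a)       ≡⟨ partition-via-decode (encode a) ⟩
    block (decode (encode a))  ≡⟨ cong block (decode-encode a) ⟩
    block a                    ≡⟨ block≡i ⟩
    i                          ∎)
    where open ≡-Reasoning

-- Lemma 4.2.
lemma4p2 : ∀ {n} (G : Graph n) (k s : ℕ) → 2 < k → 1 ≤ s → 2 * s ≤ k →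
    IsEquitable k (Power.signlessLaplacian G k s) (Power.partition G k s)
lemma4p2 G k (suc s′) _ (s≤s z≤n) _ =
  equitable-if-blocks-are-orbits partition k signlessLaplacian
    (blocks-nonempty zero) blocks-are-orbits
  where
  open Power G k (suc s′)
  open PowerHypergraph G k (suc s′)
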